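{- Let $\mathcal{H}$ be a fixed finite set of connected graphs each of diameter at most $D$, containing $K_{1,s}$ for some $s>1$, with $s$ the least such integer. Let $t>2$, $d=R(s,t-1)-1$, $p=\log_{\frac{2d}{2d-1}}d$, and let $(G,k)$ be a yes-instance of $\mathcal{H}$-free Edge Deletion with $G$ $K_t$-free. Let $V_R(G)$ be the set of vertices of $G$ of degree at least $d+1$, and let $G'$ be obtained from $G$ by deleting all vertices at distance more than $(2+\log_{\frac{2d}{2d-1}}k)D$ from $V_{\mathcal{H}}(G)\cup V_R(G)$. Then $|V(G')|\le 8d^{3D+1}\cdot k^{pD+1}$.
   Context: All graphs are finite and simple. $R(s,t)$ is the Ramsey number. A graph is $\mathcal{H}$-free if it has no induced subgraph isomorphic to a member of $\mathcal{H}$. $\mathcal{H}$-free Edge Deletion: given $G$ and a positive integer $k$, decide whether some $E'\subseteq E(G)$ with $|E'|\le k$ makes $G\setminus E'=(V(G),E(G)\setminus E')$ $\mathcal{H}$-free. $V_{\mathcal{H}}(G)$ is the set of vertices of $G$ lying in some induced copy of a member of $\mathcal{H}$. The distance from a vertex to a vertex set is the minimum distance to its elements. -}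

module Defs where

open import Data.Nat using (ℕ; zero; suc; _+_; _*_; _∸_; _^_; _≤_; _<_; _<ᵇ_)
open import Data.Bool using (Bool; true; false; _∧_; not; if_then_else_)
open import Data.Fin using (Fin; toℕ) renaming (zero to fzero)
open import Data.List using (List; map; allFin; length)
open import Data.Nat.ListAction using (sum)
open import Data.List.Membership.Propositional using (_∈_)
open import Data.List.Relation.Unary.All using (All)
open import Data.List.Relation.Unary.Unique.Propositional using (Unique)
open import Data.Product using (Σ; ∃; _×_; _,_)
open import Data.Sum using (_⊎_)
open import Relation.Binary.PropositionalEquality using (_≡_)
open import Relation.Nullary using (¬_)

record Graph (n : ℕ) : Set where
  field
    adj   : Fin n → Fin n → Bool
    sym   : ∀ u v → adj u v ≡ adj v u
    irrfl : ∀ u → adj u u ≡ false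
open Graph public

AnyGraph : Set
AnyGraph = Σ ℕ Graph

count : ∀ {n} → (Fin n → Bool) → ℕ
count {n} p = sum (map (λ i → if p i then 1 else 0) (allFin n))

degree : ∀ {n} → Graph n → Fin n → ℕ
degree G v = count (λ w → adj G v w)

data Walk {n : ℕ} (G : Graph n) : Fin n → Fin n → ℕ → Set where
  here : ∀ {u} → Walk G u u 0
  step : ∀ {u w v m} → adj G u w ≡ true → Walk G w v m → Walk G u v (suc m)

DistLe : ∀ {n} → Graph n → Fin n → Fin n → ℕ → Set
DistLe G u v m = Σ ℕ λ m' → m' ≤ m × Walk G u v m'

ConnDiamLe : AnyGraph → ℕ → Set
ConnDiamLe (n , G) D = 1 ≤ n × (∀ u v → DistLe G u v D)

Injective : ∀ {a b} → (Fin a → Fin b) → Set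
Injective f = ∀ i j → f i ≡ f j → i ≡ j

InducedEmb : AnyGraph → ∀ {n} → Graph n → Set
InducedEmb (m , H) {n} G =
  Σ (Fin m → Fin n) λ f → Injective f × (∀ a b → adj H a b ≡ adj G (f a) (f b))

Iso : AnyGraph → AnyGraph → Set
Iso (m , H) (n , G) =
  Σ (Fin m → Fin n) λ f → Σ (Fin n → Fin m) λ g →
    (∀ a → g (f a) ≡ a) × (∀ b → f (g b) ≡ b) × (∀ a b → adj H a b ≡ adj G (f a) (f b))

Free : List AnyGraph → ∀ {n} → Graph n → Set
Free ℋ G = ∀ H → H ∈ ℋ → ¬ InducedEmb H G

-- Star K_{1,s}: vertex 0 is the centre, vertices 1..s are leaves.
isZero : ∀ {n} → Fin n → Bool
isZero fzero = true
isZero (Fin.suc _) = false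

xor : Bool → Bool → Bool
xor true b = not b
xor false b = b

star : ℕ → AnyGraph
star s = suc s , record { adj = λ i j → xor (isZero i) (isZero j) ; sym = symP ; irrfl = irr }
  where
  symP : ∀ (u v : Fin (suc s)) → xor (isZero u) (isZero v) ≡ xor (isZero v) (isZero u)
  symP fzero fzero = _≡_.refl
  symP fzero (Fin.suc v) = _≡_.refl
  symP (Fin.suc u) fzero = _≡_.refl
  symP (Fin.suc u) (Fin.suc v) = _≡_.refl
  irr : ∀ (u : Fin (suc s)) → xor (isZero u) (isZero u) ≡ false
  irr fzero = _≡_.refl
  irr (Fin.suc u) = _≡_.refl

ContainsStar : List AnyGraph → ℕ → Set
ContainsStar ℋ s = Σ AnyGraph λ H → H ∈ ℋ × Iso H (star s)

HasClique : ∀ {n} → Graph n → ℕ → Set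
HasClique {n} G a = Σ (Fin a → Fin n) λ f → Injective f ×
  (∀ i j → ¬ (i ≡ j) → adj G (f i) (f j) ≡ true)

HasIndep : ∀ {n} → Graph n → ℕ → Set
HasIndep {n} G a = Σ (Fin a → Fin n) λ f → Injective f ×
  (∀ i j → adj G (f i) (f j) ≡ false)

RamseyProp : ℕ → ℕ → ℕ → Set
RamseyProp a b N = ∀ (G : Graph N) → HasClique G a ⊎ HasIndep G b

IsRamseyNumber : ℕ → ℕ → ℕ → Set
IsRamseyNumber a b R = RamseyProp a b R × (∀ M → M < R → ¬ RamseyProp a b M)

removedEdges : ∀ {n} → Graph n → Graph n → ℕ
removedEdges {n} G G' =
  sum (map (λ u → count (λ v → (toℕ u <ᵇ toℕ v) ∧ (adj G u v ∧ not (adj G' u v)))) (allFin n))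

IsEdgeDeletion : ∀ {n} → Graph n → Graph n → Set
IsEdgeDeletion G G' = ∀ u v → adj G' u v ≡ true → adj G u v ≡ true

YesInstance : List AnyGraph → ∀ {n} → Graph n → ℕ → Set
YesInstance ℋ {n} G k =
  Σ (Graph n) λ G' → IsEdgeDeletion G G' × removedEdges G G' ≤ k × Free ℋ G'

InVH : List AnyGraph → ∀ {n} → Graph n → Fin n → Set
InVH ℋ {n} G v = Σ AnyGraph λ H → H ∈ ℋ × (Σ (InducedEmb H G) λ e →
  Σ (Fin (Data.Product.proj₁ H)) λ a → Data.Product.proj₁ e a ≡ v)

InVR : ∀ {n} → Graph n → ℕ → Fin n → Set
InVR G d v = suc d ≤ degree G v

-- Distance threshold: m ≤ (2 + log_{2d/(2d-1)} k)·D, rewritten over ℕ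
-- (valid for k ≥ 1, d ≥ 1) as (2d)^(m∸2D) ≤ k^D · (2d-1)^(m∸2D).
WithinThreshold : ℕ → ℕ → ℕ → ℕ → Set
WithinThreshold d k D m = (2 * d) ^ (m ∸ 2 * D) ≤ k ^ D * (2 * d ∸ 1) ^ (m ∸ 2 * D)

-- v is a vertex of G': distance from v to V_ℋ(G) ∪ V_R(G) is within the threshold.
Kept : List AnyGraph → ∀ {n} → Graph n → ℕ → ℕ → ℕ → Fin n → Set
Kept ℋ G d k D v = Σ _ λ w → (InVH ℋ G w ⊎ InVR G d w) ×
  (Σ ℕ λ m → Walk G v w m × WithinThreshold d k D m)

-- |V(G')| ≤ 8 d^(3D+1) k^(pD+1), with p = log_{2d/(2d-1)} d, stated over ℕ as:
-- for every rational u/v > log_{2d/(2d-1)} k (i.e. k^v (2d-1)^u < (2d)^u, v ≥ 1),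
-- N^v ≤ (8 d^(3D+1) k)^v · d^(D u).
SizeBound : ℕ → ℕ → ℕ → ℕ → Set
SizeBound d k D N = ∀ u v → 1 ≤ v → k ^ v * (2 * d ∸ 1) ^ u < (2 * d) ^ u →
  N ^ v ≤ (8 * d ^ (3 * D + 1) * k) ^ v * d ^ (D * u)

{-# OPTIONS --safe #-}
-- Fix a solution G′ = G ∖ E′ with |E′| ≤ k. By Ramsey's theorem on its neighbourhood, a vertex of
-- degree ≥ R(s,t−1) in G′ would be the centre of an induced K_{1,s} (impossible, as G′ is ℋ-free) or
-- lie in a K_t (impossible, as G is K_t-free), so G′ has maximum degree d. Let S be the set of the at
-- most 2k endpoints of E′. Every vertex of V_R(G) is in S, and every induced copy in G of a member of
-- ℋ loses an edge, so V_ℋ(G) lies within distance D of S. Outside S the degrees in G are those in G′,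
-- so non-backtracking walks leaving S branch at most d − 1 ways per step, and at most d^r (d+1) |S|
-- vertices lie within distance r of S. The distance threshold gives r ≤ 3D + ⌊Du/v⌋ for every
-- rational u/v > log_{2d/(2d−1)} k, which is the bound in the form of SizeBound.

module Submission where

open import Defs
open import Data.Nat using (ℕ; suc; _∸_; _≤_; _<_)
open import Data.Fin using (Fin)
open import Data.List using (List; length)
open import Data.List.Membership.Propositional using (_∈_)
open import Data.List.Relation.Unary.All using (All)
open import Data.List.Relation.Unary.Unique.Propositional using (Unique)
open import Relation.Binary.PropositionalEquality using (_≡_)
open import Relation.Nullary using (¬_)

open import Data.Bool using (Bool; true; false; _∧_; not; if_then_else_)
open import Data.Bool.Properties using (∧-conicalˡ; ∧-conicalʳ; ∧-zeroʳ; ¬-not; not-injective; T-≡)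
  renaming (_≟_ to _≟ᵇ_)
open import Data.Fin using (toℕ; inject≤; zero; suc)
open import Data.Fin.Properties
  using (_≟_; any?; ¬∀⟶∃¬; injective⇒≤; inject≤-injective; toℕ-injective)
open import Data.List using ([]; _∷_; _++_; map; concatMap; filter; allFin; lookup)
open import Data.List.Properties using (length-++; length-map; map-cong)
open import Data.List.Membership.Propositional using (find; lose)
open import Data.List.Membership.Propositional.Properties
  using (∈-lookup; ∈-allFin; ∈-filter⁺; ∈-filter⁻; ∈-map⁺; ∈-map⁻; ∈-++⁺ˡ; ∈-++⁺ʳ;
         ∈-concatMap⁺; ∈-concatMap⁻)
open import Data.List.Membership.Setoid.Properties using (index-injective)
open import Data.List.Relation.Binary.Subset.Propositional using (_⊆_)
open import Data.List.Relation.Unary.All as All using ()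
open import Data.List.Relation.Unary.AllPairs using ([]; _∷_)
open import Data.List.Relation.Unary.Any using (here; there)
open import Data.List.Relation.Unary.Unique.Propositional.Properties using (allFin⁺; filter⁺)
open import Data.Nat
  using (zero; _+_; _*_; _^_; _<ᵇ_; z≤n; s≤s; _≤′_; ≤′-refl; ≤′-step; NonZero; >-nonZero; >-nonZero⁻¹)
open import Data.Nat.ListAction using (sum)
open import Data.Nat.DivMod using (_/_; m*n/n≡m; m/n*n≤m; /-monoˡ-≤)
open import Data.Nat.Tactic.RingSolver using (solve-∀)
open import Data.Nat.Properties hiding (_≟_)
open import Algebra.Properties.CommutativeSemigroup *-commutativeSemigroup using (xy∙z≈xz∙y)
open import Data.Product as Product using (Σ; ∃; ∃₂; _×_; _,_; proj₁; proj₂)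
open import Data.Sum as Sum using (_⊎_; inj₁; inj₂; [_,_]′)
import Data.Vec.Functional as V
open import Function.Bundles using (mk⇔; Equivalence)
open import Function using (_∘_; id)
open import Relation.Binary.Definitions using (tri<; tri≈; tri>)
open import Relation.Binary.PropositionalEquality
  using (refl; trans; cong; cong₂; subst; _≢_; setoid)
import Relation.Binary.PropositionalEquality as ≡
open import Relation.Nullary using (yes; no; does)
open import Relation.Nullary.Decidable using (dec-true; dec-false; does-⇔)
open import Relation.Nullary.Negation using (contradiction)

module _ {A : Set} where

  lookup-injective : ∀ {xs : List A} → Unique xs → ∀ {i j} → lookup xs i ≡ lookup xs j → i ≡ j
  lookup-injective {_ ∷ _} _ {zero} {zero} _ = refl
  lookup-injective {_ ∷ _} (x∉xs ∷ _) {zero} {suc j} eq =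
    contradiction eq (All.lookup x∉xs (∈-lookup j))
  lookup-injective {_ ∷ _} (x∉xs ∷ _) {suc i} {zero} eq =
    contradiction (≡.sym eq) (All.lookup x∉xs (∈-lookup i))
  lookup-injective {_ ∷ _} (_ ∷ u) {suc i} {suc j} eq = cong suc (lookup-injective u eq)

  Unique-⊆⇒length≤ : ∀ {xs ys : List A} → Unique xs → xs ⊆ ys → length xs ≤ length ys
  Unique-⊆⇒length≤ u xs⊆ys = injective⇒≤ λ eq →
    lookup-injective u (index-injective (setoid A) (xs⊆ys (∈-lookup _)) (xs⊆ys (∈-lookup _)) eq)

  length-concatMap : ∀ {B : Set} (f : A → List B) xs → length (concatMap f xs) ≡ sum (map (length ∘ f) xs)
  length-concatMap f [] = refl
  length-concatMap f (x ∷ xs) = trans (length-++ (f x)) (cong (length (f x) +_) (length-concatMap f xs))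

  length-concatMap-≤ : ∀ {B : Set} {f : A → List B} {m} xs → (∀ {x} → x ∈ xs → length (f x) ≤ m) →
    length (concatMap f xs) ≤ m * length xs
  length-concatMap-≤ {m = m} [] _ = ≤-reflexive (≡.sym (*-zeroʳ m))
  length-concatMap-≤ {f = f} {m} (x ∷ xs) bound = begin
    length (f x ++ concatMap f xs)         ≡⟨ length-++ (f x) ⟩
    length (f x) + length (concatMap f xs) ≤⟨ +-mono-≤ (bound (here refl))
                                                         (length-concatMap-≤ xs (bound ∘ there)) ⟩
    m + m * length xs                      ≡⟨ ≡.sym (*-suc m (length xs)) ⟩
    m * suc (length xs)                    ∎
    where open ≤-Reasoning

module _ {n : ℕ} where

  select : (Fin n → Bool) → List (Fin n)
  select p = filter (λ i → p i ≟ᵇ true) (allFin n)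

  length-select : ∀ p → length (select p) ≡ count p
  length-select p = go (allFin n)
    where
    go : ∀ xs → length (filter (λ i → p i ≟ᵇ true) xs) ≡ sum (map (λ i → if p i then 1 else 0) xs)
    go [] = refl
    go (x ∷ xs) with p x
    ... | true = cong suc (go xs)
    ... | false = go xs

  ∈-select⁺ : ∀ {p i} → p i ≡ true → i ∈ select p
  ∈-select⁺ = ∈-filter⁺ _ (∈-allFin _)

  ∈-select⁻ : ∀ {p i} → i ∈ select p → p i ≡ true
  ∈-select⁻ {p} = proj₂ ∘ ∈-filter⁻ (λ i → p i ≟ᵇ true) {xs = allFin n}

  select-unique : ∀ p → Unique (select p)
  select-unique p = filter⁺ _ (allFin⁺ n)

  count-mono : ∀ {p q} → (∀ {i} → p i ≡ true → q i ≡ true) → count p ≤ count q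
  count-mono {p} {q} p⊆q = begin
    count p             ≡⟨ length-select p ⟨
    length (select p)   ≤⟨ Unique-⊆⇒length≤ (select-unique p) (∈-select⁺ ∘ p⊆q ∘ ∈-select⁻) ⟩
    length (select q)   ≡⟨ length-select q ⟩
    count q             ∎
    where open ≤-Reasoning

  count-mono-< : ∀ {p q a} → (∀ {i} → p i ≡ true → q i ≡ true) → p a ≡ false → q a ≡ true →
    count p < count q
  count-mono-< {p} {q} {a} p⊆q pa qa = begin-strict
    count p             ≡⟨ length-select p ⟨
    length (select p)   <⟨ Unique-⊆⇒length≤ (a∉ ∷ select-unique p) a∷p⊆q ⟩
    length (select q)   ≡⟨ length-select q ⟩
    count q             ∎
    where
    open ≤-Reasoning
    a∉ : All (a ≢_) (select p)
    a∉ = All.tabulate λ i∈ a≡i →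
      contradiction (trans (≡.sym pa) (trans (cong p a≡i) (∈-select⁻ i∈))) λ ()
    a∷p⊆q : (a ∷ select p) ⊆ select q
    a∷p⊆q (here refl) = ∈-select⁺ qa
    a∷p⊆q (there i∈) = ∈-select⁺ (p⊆q (∈-select⁻ i∈))

  count≥⇒injection : ∀ {p R} → R ≤ count p →
    Σ (Fin R → Fin n) λ g → Injective g × (∀ i → p (g i) ≡ true)
  count≥⇒injection {p} {R} R≤count = g , g-injective , ∈-select⁻ ∘ ∈-lookup ∘ ι
    where
    R≤length : R ≤ length (select p)
    R≤length = subst (R ≤_) (≡.sym (length-select p)) R≤count
    ι : Fin R → Fin (length (select p))
    ι i = inject≤ i R≤length
    g : Fin R → Fin n
    g = lookup (select p) ∘ ι
    g-injective : Injective g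
    g-injective i j = inject≤-injective _ _ i j ∘ lookup-injective (select-unique p)

  arcsFrom : Fin n → (Fin n → Bool) → List (Fin n × Fin n)
  arcsFrom x q = map (x ,_) (select q)

  length-arcsFrom : ∀ x q → length (arcsFrom x q) ≡ count q
  length-arcsFrom x q = trans (length-map (x ,_) (select q)) (length-select q)

  ∈-arcsFrom⁺ : ∀ {x y q} → q y ≡ true → (x , y) ∈ arcsFrom x q
  ∈-arcsFrom⁺ = ∈-map⁺ _ ∘ ∈-select⁺

  ∈-arcsFrom⁻ : ∀ {x y z q} → (z , y) ∈ arcsFrom x q → z ≡ x × q y ≡ true
  ∈-arcsFrom⁻ zy∈ with ∈-map⁻ _ zy∈
  ... | _ , y∈ , refl = refl , ∈-select⁻ y∈

walk-++ : ∀ {n} {G : Graph n} {u v w a b} → Walk G u v a → Walk G v w b → Walk G u w (a + b)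
walk-++ here q = q
walk-++ (step e p) q = step e (walk-++ p q)

walk-map : ∀ {m n} {H : Graph m} {G : Graph n} (f : Fin m → Fin n) →
  (∀ a b → adj H a b ≡ adj G (f a) (f b)) → ∀ {u v l} → Walk H u v l → Walk G (f u) (f v) l
walk-map f f-adj here = here
walk-map f f-adj (step {u} {w} e p) = step (trans (≡.sym (f-adj u w)) e) (walk-map f f-adj p)

module _ {n : ℕ} (G : Graph n) where

  adj⇒≢ : ∀ {x y} → adj G x y ≡ true → x ≢ y
  adj⇒≢ {x} xy refl = contradiction (trans (≡.sym (irrfl G x)) xy) λ ()

  cone-injective : ∀ {m x} {h : Fin m → Fin n} → Injective h → (∀ i → adj G x (h i) ≡ true) →
    Injective (x V.∷ h)
  cone-injective h-inj x~h zero zero _ = refl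
  cone-injective h-inj x~h zero (suc j) eq = contradiction eq (adj⇒≢ (x~h j))
  cone-injective h-inj x~h (suc i) zero eq = contradiction (≡.sym eq) (adj⇒≢ (x~h i))
  cone-injective h-inj x~h (suc i) (suc j) eq = cong suc (h-inj i j eq)

  independent-neighbours⇒star : ∀ {s x} (I : HasIndep G s) → (∀ i → adj G x (proj₁ I i) ≡ true) →
    InducedEmb (star s) G
  independent-neighbours⇒star {x = x} (h , h-inj , h-indep) x~h =
    x V.∷ h , cone-injective h-inj x~h , star-adj
    where
    star-adj : ∀ a b → adj (proj₂ (star _)) a b ≡ adj G ((x V.∷ h) a) ((x V.∷ h) b)
    star-adj zero zero = ≡.sym (irrfl G x)
    star-adj zero (suc j) = ≡.sym (x~h j)
    star-adj (suc i) zero = ≡.sym (trans (sym G (h i) x) (x~h i))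
    star-adj (suc i) (suc j) = ≡.sym (h-indep i j)

  clique-neighbours⇒clique : ∀ {t x} (K : HasClique G t) → (∀ i → adj G x (proj₁ K i) ≡ true) →
    HasClique G (suc t)
  clique-neighbours⇒clique {x = x} (h , h-inj , h-clique) x~h =
    x V.∷ h , cone-injective h-inj x~h , clique-adj
    where
    clique-adj : ∀ a b → a ≢ b → adj G ((x V.∷ h) a) ((x V.∷ h) b) ≡ true
    clique-adj zero zero a≢b = contradiction refl a≢b
    clique-adj zero (suc j) _ = x~h j
    clique-adj (suc i) zero _ = trans (sym G (h i) x) (x~h i)
    clique-adj (suc i) (suc j) a≢b = h-clique i j (a≢b ∘ cong suc)

  complementOn : ∀ {m} → (Fin m → Fin n) → Graph m
  complementOn g = record
    { adj = λ i j → not (does (i ≟ j)) ∧ not (adj G (g i) (g j))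
    ; sym = λ i j → cong₂ (λ a b → not a ∧ not b)
                      (does-⇔ (mk⇔ ≡.sym ≡.sym) (i ≟ j) (j ≟ i)) (sym G (g i) (g j))
    ; irrfl = λ i → cong (λ a → not a ∧ _) (dec-true (i ≟ i) refl)
    }

  complementOn-adj : ∀ {m} (g : Fin m → Fin n) {i j} → i ≢ j →
    adj (complementOn g) i j ≡ not (adj G (g i) (g j))
  complementOn-adj g {i} {j} i≢j = cong (λ a → not a ∧ _) (dec-false (i ≟ j) i≢j)

  star-or-clique : ∀ {s t R x} → RamseyProp s t R → R ≤ degree G x →
    InducedEmb (star s) G ⊎ HasClique G (suc t)
  star-or-clique {s} {t} ramsey R≤degree with count≥⇒injection R≤degree
  ... | g , g-inj , x~g = Sum.map star-on-neighbours clique-on-neighbours (ramsey (complementOn g))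
    where
    compose : ∀ {m} {f : Fin m → Fin _} → Injective f → Injective (g ∘ f)
    compose f-inj i j = f-inj i j ∘ g-inj _ _

    star-on-neighbours : HasClique (complementOn g) s → InducedEmb (star s) G
    star-on-neighbours (f , f-inj , f-clique) =
      independent-neighbours⇒star (g ∘ f , compose f-inj , independent) (x~g ∘ f)
      where
      independent : ∀ i j → adj G (g (f i)) (g (f j)) ≡ false
      independent i j with i ≟ j
      ... | yes refl = irrfl G (g (f i))
      ... | no i≢j = not-injective
            (trans (≡.sym (complementOn-adj g (i≢j ∘ f-inj i j))) (f-clique i j i≢j))

    clique-on-neighbours : HasIndep (complementOn g) t → HasClique G (suc t)
    clique-on-neighbours (f , f-inj , f-indep) =
      clique-neighbours⇒clique (g ∘ f , compose f-inj , clique) (x~g ∘ f)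
      where
      clique : ∀ i j → i ≢ j → adj G (g (f i)) (g (f j)) ≡ true
      clique i j i≢j = not-injective
        (trans (≡.sym (complementOn-adj g (i≢j ∘ f-inj i j))) (f-indep i j))

  degree<Ramsey : ∀ {s t R} → RamseyProp s t R → ¬ InducedEmb (star s) G → ¬ HasClique G (suc t) →
    ∀ x → degree G x < R
  degree<Ramsey ramsey no-star no-clique x =
    ≰⇒> λ R≤degree → [ no-star , no-clique ]′ (star-or-clique ramsey R≤degree)

emptyGraph : ∀ {n} → Graph n
emptyGraph = record { adj = λ _ _ → false ; sym = λ _ _ → refl ; irrfl = λ _ → refl }

ramsey-number≥2 : ∀ {s t R} → 2 ≤ s → 2 ≤ t → RamseyProp s t R → 2 ≤ R
ramsey-number≥2 2≤s 2≤t ramsey with ramsey emptyGraph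
... | inj₁ (f , f-inj , _) = ≤-trans 2≤s (injective⇒≤ (f-inj _ _))
... | inj₂ (f , f-inj , _) = ≤-trans 2≤t (injective⇒≤ (f-inj _ _))

InducedEmb-resp-Iso : ∀ {H K n} {G : Graph n} → Iso H K → InducedEmb K G → InducedEmb H G
InducedEmb-resp-Iso (f , g , gf , _ , f-adj) (e , e-inj , e-adj) =
  e ∘ f ,
  (λ i j eq → trans (≡.sym (gf i)) (trans (cong g (e-inj (f i) (f j) eq)) (gf j))) ,
  (λ a b → trans (f-adj a b) (e-adj (f a) (f b)))

HasClique-resp-deletion : ∀ {n t} {G G′ : Graph n} → IsEdgeDeletion G G′ → HasClique G′ t → HasClique G t
HasClique-resp-deletion G′⊆G (f , f-inj , f-clique) = f , f-inj , λ i j i≢j → G′⊆G _ _ (f-clique i j i≢j)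

-- layer l lists, with repetitions, the last arcs (p , c) of the non-backtracking walks of length l + 1
-- that start in S and then stay outside S; ball r lists every vertex within distance r of S.
module Ball {n : ℕ} (G : Graph n) (S : Fin n → Bool) where

  Arc : Set
  Arc = Fin n × Fin n

  exits : Fin n → Fin n → Bool
  exits x y = adj G x y ∧ not (S y)

  continues : Arc → Fin n → Bool
  continues (p , c) y = exits c y ∧ not (does (y ≟ p))

  firstArcs : Fin n → List Arc
  firstArcs x = arcsFrom x (exits x)

  nextArcs : Arc → List Arc
  nextArcs a = arcsFrom (proj₂ a) (continues a)

  layer : ℕ → List Arc
  layer zero = concatMap firstArcs (select S)
  layer (suc l) = concatMap nextArcs (layer l)

  ball : ℕ → List (Fin n)
  ball zero = select S
  ball (suc r) = ball r ++ map proj₂ (layer r)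

  exits-true : ∀ {x y} → adj G x y ≡ true → S y ≡ false → exits x y ≡ true
  exits-true xy Sy = cong₂ (λ a b → a ∧ not b) xy Sy

  ∈-layer-zero⁺ : ∀ {x y} → S x ≡ true → adj G x y ≡ true → S y ≡ false → (x , y) ∈ layer 0
  ∈-layer-zero⁺ Sx xy Sy =
    ∈-concatMap⁺ firstArcs (lose (∈-select⁺ Sx) (∈-arcsFrom⁺ (exits-true xy Sy)))

  ∈-layer-suc⁺ : ∀ l {p c y} → (p , c) ∈ layer l → adj G c y ≡ true → y ≢ p → S y ≡ false →
    (c , y) ∈ layer (suc l)
  ∈-layer-suc⁺ l {p} {y = y} pc∈ cy y≢p Sy =
    ∈-concatMap⁺ nextArcs (lose pc∈ (∈-arcsFrom⁺ continues-py))
    where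
    continues-py : continues (p , _) y ≡ true
    continues-py = cong₂ _∧_ (exits-true cy Sy) (cong not (dec-false (y ≟ p) y≢p))

  ∈-layer-zero⁻ : ∀ {x y} → (x , y) ∈ layer 0 → S x ≡ true × exits x y ≡ true
  ∈-layer-zero⁻ xy∈ with find (∈-concatMap⁻ firstArcs xy∈)
  ... | x′ , x′∈ , xy∈′ with ∈-arcsFrom⁻ {x = x′} xy∈′
  ...   | refl , exits-xy = ∈-select⁻ x′∈ , exits-xy

  ∈-layer-suc⁻ : ∀ l {c y} → (c , y) ∈ layer (suc l) →
    ∃ λ p → (p , c) ∈ layer l × continues (p , c) y ≡ true
  ∈-layer-suc⁻ l cy∈ with find (∈-concatMap⁻ nextArcs {xs = layer l} cy∈)
  ... | (p , c′) , pc∈ , cy∈′ with ∈-arcsFrom⁻ {x = c′} cy∈′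
  ...   | refl , continues-py = p , pc∈ , continues-py

  layer-exits : ∀ l {p c} → (p , c) ∈ layer l → exits p c ≡ true
  layer-exits zero pc∈ = proj₂ (∈-layer-zero⁻ pc∈)
  layer-exits (suc l) pc∈ = ∧-conicalˡ _ _ (proj₂ (proj₂ (∈-layer-suc⁻ l pc∈)))

  module _ {c : ℕ} (low-degree : ∀ {x} → S x ≡ false → degree G x ≤ suc c) where

    count-continues : ∀ {p x} → exits p x ≡ true → count (continues (p , x)) ≤ c
    count-continues {p} {x} px = ≤-pred (begin-strict
      count (continues (p , x)) <⟨ count-mono-< {p = continues (p , x)} {q = adj G x}
                                      (∧-conicalˡ _ _ ∘ ∧-conicalˡ _ _) backtrack xp ⟩
      degree G x               ≤⟨ low-degree (not-injective (∧-conicalʳ _ _ px)) ⟩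
      suc c                    ∎)
      where
      open ≤-Reasoning
      backtrack : continues (p , x) p ≡ false
      backtrack = trans (cong (λ b → exits x p ∧ not b) (dec-true (p ≟ p) refl)) (∧-zeroʳ (exits x p))
      xp : adj G x p ≡ true
      xp = trans (sym G x p) (∧-conicalˡ _ _ px)

    length-layer-suc : ∀ l → length (layer (suc l)) ≤ c * length (layer l)
    length-layer-suc l = length-concatMap-≤ (layer l) λ {a} a∈ →
      ≤-trans (≤-reflexive (length-arcsFrom (proj₂ a) (continues a)))
              (count-continues (layer-exits l a∈))

    length-ball+layer : ∀ r →
      length (ball r) + length (layer r) ≤ suc c ^ r * (count S + length (layer 0))
    length-ball+layer zero = ≤-reflexive (trans (cong (_+ length (layer 0)) (length-select S))
                                                 (≡.sym (*-identityˡ _)))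
    length-ball+layer (suc r) = begin
      length (ball r ++ map proj₂ (layer r)) + length (layer (suc r))
        ≡⟨ cong (_+ length (layer (suc r)))
                (trans (length-++ (ball r)) (cong (B +_) (length-map proj₂ (layer r)))) ⟩
      B + L + length (layer (suc r))   ≤⟨ +-monoʳ-≤ (B + L) (length-layer-suc r) ⟩
      B + L + c * L                    ≤⟨ +-monoʳ-≤ (B + L) (*-monoʳ-≤ c (m≤n+m L B)) ⟩
      suc c * (B + L)                  ≤⟨ *-monoʳ-≤ (suc c) (length-ball+layer r) ⟩
      suc c * (suc c ^ r * X)          ≡⟨ *-assoc (suc c) (suc c ^ r) X ⟨
      suc c ^ suc r * X                ∎
      where
      open ≤-Reasoning
      B = length (ball r)
      L = length (layer r)
      X = count S + length (layer 0)

    length-ball : (∀ {x} → S x ≡ true → count (exits x) ≤ suc c) →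
      ∀ r → length (ball r) ≤ suc c ^ r * (suc (suc c) * count S)
    length-ball few-exits r = begin
      length (ball r)                           ≤⟨ m≤m+n _ _ ⟩
      length (ball r) + length (layer r)        ≤⟨ length-ball+layer r ⟩
      suc c ^ r * (count S + length (layer 0))  ≤⟨ *-monoʳ-≤ (suc c ^ r)
                                                     (+-monoʳ-≤ (count S) length-layer-zero) ⟩
      suc c ^ r * (count S + suc c * count S)   ∎
      where
      open ≤-Reasoning
      length-layer-zero : length (layer 0) ≤ suc c * count S
      length-layer-zero = begin
        length (layer 0)            ≤⟨ length-concatMap-≤ (select S) (λ x∈ →
                                         ≤-trans (≤-reflexive (length-arcsFrom _ (exits _)))
                                                 (few-exits (∈-select⁻ x∈))) ⟩
        suc c * length (select S)   ≡⟨ cong (suc c *_) (length-select S) ⟩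
        suc c * count S             ∎

  Reached : Fin n → ℕ → Set
  Reached v ℓ = S v ≡ true ⊎ ∃₂ λ p l → l < ℓ × (p , v) ∈ layer l

  Reached-mono : ∀ {v ℓ ℓ′} → ℓ ≤ ℓ′ → Reached v ℓ → Reached v ℓ′
  Reached-mono _ (inj₁ Sv) = inj₁ Sv
  Reached-mono ℓ≤ℓ′ (inj₂ (p , l , l<ℓ , pv∈)) = inj₂ (p , l , <-≤-trans l<ℓ ℓ≤ℓ′ , pv∈)

  source-reached : ∀ l {p c} → (p , c) ∈ layer l → Reached p l
  source-reached zero pc∈ = inj₁ (proj₁ (∈-layer-zero⁻ pc∈))
  source-reached (suc l) pc∈ with ∈-layer-suc⁻ l pc∈
  ... | p′ , p′p∈ , _ = inj₂ (p′ , l , ≤-refl , p′p∈)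

  walk-reached : ∀ {v x ℓ} → Walk G v x ℓ → S x ≡ true → Reached v ℓ
  walk-reached here Sx = inj₁ Sx
  walk-reached {v} (step {w = w} vw w⇝x) Sx with S v ≟ᵇ true | walk-reached w⇝x Sx
  ... | yes Sv | _ = inj₁ Sv
  ... | no Sv≢true | inj₁ Sw =
    inj₂ (w , 0 , s≤s z≤n , ∈-layer-zero⁺ Sw (trans (sym G w v) vw) (¬-not Sv≢true))
  ... | no Sv≢true | inj₂ (p , l , l<ℓ , pw∈) with v ≟ p
  ...   | yes refl = Reached-mono (m≤n⇒m≤1+n (<⇒≤ l<ℓ)) (source-reached l pw∈)
  ...   | no v≢p =
    inj₂ (w , suc l , s≤s l<ℓ , ∈-layer-suc⁺ l pw∈ (trans (sym G w v) vw) v≢p (¬-not Sv≢true))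

  ball-mono : ∀ {r r′} → r ≤′ r′ → ball r ⊆ ball r′
  ball-mono ≤′-refl = id
  ball-mono (≤′-step r≤r′) = ∈-++⁺ˡ ∘ ball-mono r≤r′

  walk⇒∈ball : ∀ {v x ℓ} r → Walk G v x ℓ → S x ≡ true → ℓ ≤ r → v ∈ ball r
  walk⇒∈ball r v⇝x Sx ℓ≤r with walk-reached v⇝x Sx
  ... | inj₁ Sv = ball-mono {0} {r} (≤⇒≤′ z≤n) (∈-select⁺ Sv)
  ... | inj₂ (p , l , l<ℓ , pv∈) =
    ball-mono {suc l} {r} (≤⇒≤′ (≤-trans l<ℓ ℓ≤r)) (∈-++⁺ʳ (ball l) (∈-map⁺ proj₂ pv∈))

module EdgeDeletion {n : ℕ} (G G′ : Graph n) (G′⊆G : IsEdgeDeletion G G′) where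

  deleted : Fin n → Fin n → Bool
  deleted x y = adj G x y ∧ not (adj G′ x y)

  touched : Fin n → Bool
  touched x = does (any? λ y → deleted x y ≟ᵇ true)

  deleted⇒touched : ∀ {x y} → deleted x y ≡ true → touched x ≡ true
  deleted⇒touched {y = y} xy = dec-true (any? _) (y , xy)

  touched⇒deleted : ∀ {x} → touched x ≡ true → ∃ λ y → deleted x y ≡ true
  touched⇒deleted {x} touched-x with any? (λ y → deleted x y ≟ᵇ true)
  ... | yes witness = witness
  ... | no _ = contradiction touched-x λ ()

  untouched⇒adj≡ : ∀ {x} → touched x ≡ false → ∀ y → adj G x y ≡ adj G′ x y
  untouched⇒adj≡ {x} untouched y with adj G′ x y in x~′y
  ... | true = G′⊆G x y x~′y
  ... | false = ¬-not λ x~y → contradiction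
        (trans (≡.sym untouched) (deleted⇒touched (cong₂ (λ a b → a ∧ not b) x~y x~′y))) λ ()

  untouched⇒degree≡ : ∀ {x} → touched x ≡ false → degree G x ≡ degree G′ x
  untouched⇒degree≡ untouched =
    cong sum (map-cong (cong (λ b → if b then 1 else 0) ∘ untouched⇒adj≡ untouched) (allFin n))

  count-untouched-neighbours : ∀ x → count (λ y → adj G x y ∧ not (touched y)) ≤ degree G′ x
  count-untouched-neighbours x = count-mono λ {y} x~y∧untouched →
    let y-untouched = not-injective (∧-conicalʳ _ _ x~y∧untouched)
    in trans (sym G′ x y) (trans (≡.sym (untouched⇒adj≡ y-untouched x))
                                 (trans (sym G y x) (∧-conicalˡ _ _ x~y∧untouched)))

  deletedForward : Fin n → Fin n → Bool
  deletedForward u v = (toℕ u <ᵇ toℕ v) ∧ deleted u v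

  deletedEdges : List (Fin n × Fin n)
  deletedEdges = concatMap (λ u → arcsFrom u (deletedForward u)) (allFin n)

  length-deletedEdges : length deletedEdges ≡ removedEdges G G′
  length-deletedEdges = trans (length-concatMap _ (allFin n))
    (cong sum (map-cong (λ u → length-arcsFrom u (deletedForward u)) (allFin n)))

  ∈-deletedEdges : ∀ {u v} → toℕ u < toℕ v → deleted u v ≡ true → (u , v) ∈ deletedEdges
  ∈-deletedEdges {u} u<v uv = ∈-concatMap⁺ (λ u → arcsFrom u (deletedForward u))
    (lose (∈-allFin u) (∈-arcsFrom⁺ (cong₂ _∧_ (Equivalence.to T-≡ (<⇒<ᵇ u<v)) uv)))

  touched⇒endpoint : ∀ {x} → touched x ≡ true → x ∈ map proj₁ deletedEdges ++ map proj₂ deletedEdges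
  touched⇒endpoint {x} touched-x with touched⇒deleted touched-x
  ... | y , xy with <-cmp (toℕ x) (toℕ y)
  ...   | tri< x<y _ _ = ∈-++⁺ˡ (∈-map⁺ proj₁ (∈-deletedEdges x<y xy))
  ...   | tri≈ _ x≡y _ = contradiction (toℕ-injective x≡y) (adj⇒≢ G (∧-conicalˡ _ _ xy))
  ...   | tri> _ _ y<x = ∈-++⁺ʳ (map proj₁ deletedEdges) (∈-map⁺ proj₂ (∈-deletedEdges y<x yx))
    where
    yx : deleted y x ≡ true
    yx = trans (cong₂ (λ a b → a ∧ not b) (sym G y x) (sym G′ y x)) xy

  count-touched : count touched ≤ 2 * removedEdges G G′
  count-touched = begin
    count touched                                             ≡⟨ length-select touched ⟨
    length (select touched)                                   ≤⟨ Unique-⊆⇒length≤ (select-unique touched)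
                                                                   (touched⇒endpoint ∘ ∈-select⁻) ⟩
    length (map proj₁ deletedEdges ++ map proj₂ deletedEdges) ≡⟨ length-++ (map proj₁ deletedEdges) ⟩
    length (map proj₁ deletedEdges) + length (map proj₂ deletedEdges)
                                                              ≡⟨ cong₂ _+_ (length-map proj₁ deletedEdges)
                                                                            (length-map proj₂ deletedEdges) ⟩
    length deletedEdges + length deletedEdges                 ≡⟨ cong (λ m → m + m) length-deletedEdges ⟩
    removedEdges G G′ + removedEdges G G′                     ≡⟨ cong (removedEdges G G′ +_) (+-identityʳ _) ⟨
    2 * removedEdges G G′                                     ∎
    where open ≤-Reasoning

  destroyed-copy⇒touched : ∀ {m} {H : Graph m} (e : InducedEmb (m , H) G) → ¬ InducedEmb (m , H) G′ →
    ∃ λ a → touched (proj₁ e a) ≡ true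
  destroyed-copy⇒touched {m} (f , f-inj , f-adj) not-in-G′ =
    Product.map₂ ¬-not (¬∀⟶∃¬ m _ (λ a → touched (f a) ≟ᵇ false) copy-survives)
    where
    copy-survives : ¬ (∀ a → touched (f a) ≡ false)
    copy-survives untouched =
      not-in-G′ (f , f-inj , λ a b → trans (f-adj a b) (untouched⇒adj≡ (untouched a) (f b)))

^-distrib-* : ∀ a b n → (a * b) ^ n ≡ a ^ n * b ^ n
^-distrib-* a b zero = refl
^-distrib-* a b (suc n) = trans (cong (a * b *_) (^-distrib-* a b n)) (middle a b (a ^ n) (b ^ n))
  where
  middle : ∀ w x y z → w * x * (y * z) ≡ w * y * (x * z)
  middle = solve-∀

^-comm-^ : ∀ a p q → (a ^ p) ^ q ≡ (a ^ q) ^ p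
^-comm-^ a p q =
  trans (^-*-assoc a p q) (trans (cong (a ^_) (*-comm p q)) (≡.sym (^-*-assoc a q p)))

ratio-powers-≤⇒≤ : ∀ {a b} m n → 0 < b → b < a → a ^ m * b ^ n ≤ a ^ n * b ^ m → m ≤ n
ratio-powers-≤⇒≤ {a} {b} m n 0<b b<a ineq with m ≤? n
... | yes m≤n = m≤n
... | no m≰n with m≤n⇒∃[o]m+o≡n (≰⇒> m≰n)
...   | o , refl = contradiction gap (<⇒≱ (^-monoˡ-< (suc o) b<a))
  where
  instance
    b≢0 : NonZero b
    b≢0 = >-nonZero 0<b
    a≢0 : NonZero a
    a≢0 = >-nonZero (<-trans 0<b b<a)
  split : ∀ x → x ^ (suc n + o) ≡ x ^ n * x ^ suc o
  split x = trans (cong (x ^_) (≡.sym (+-suc n o))) (^-distribˡ-+-* x n (suc o))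
  gap : a ^ suc o ≤ b ^ suc o
  gap = *-cancelˡ-≤ (a ^ n * b ^ n) {{m*n≢0 (a ^ n) (b ^ n) {{m^n≢0 a n}} {{m^n≢0 b n}}}}
    (begin
    a ^ n * b ^ n * a ^ suc o     ≡⟨ xy∙z≈xz∙y (a ^ n) (b ^ n) (a ^ suc o) ⟩
    a ^ n * a ^ suc o * b ^ n     ≡⟨ cong (_* b ^ n) (split a) ⟨
    a ^ (suc n + o) * b ^ n       ≤⟨ ineq ⟩
    a ^ n * b ^ (suc n + o)       ≡⟨ cong (a ^ n *_) (split b) ⟩
    a ^ n * (b ^ n * b ^ suc o)   ≡⟨ *-assoc (a ^ n) (b ^ n) (b ^ suc o) ⟨
    a ^ n * b ^ n * b ^ suc o     ∎)
    where open ≤-Reasoning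

-- Raising the first inequality to the v-th power and the second to the D-th eliminates k.
threshold⇒exponent≤ : ∀ {a b k D u v j} → 0 < b → b < a →
  a ^ j ≤ k ^ D * b ^ j → k ^ v * b ^ u ≤ a ^ u → j * v ≤ D * u
threshold⇒exponent≤ {a} {b} {k} {D} {u} {v} {j} 0<b b<a few many =
  ratio-powers-≤⇒≤ (j * v) (D * u) 0<b b<a (begin
    a ^ (j * v) * b ^ (D * u)              ≡⟨ cong (_* b ^ (D * u)) (^-*-assoc a j v) ⟨
    (a ^ j) ^ v * b ^ (D * u)              ≤⟨ *-monoˡ-≤ _ (^-monoˡ-≤ v few) ⟩
    (k ^ D * b ^ j) ^ v * b ^ (D * u)      ≡⟨ cong (_* b ^ (D * u)) (^-distrib-* (k ^ D) (b ^ j) v) ⟩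
    (k ^ D) ^ v * (b ^ j) ^ v * b ^ (D * u) ≡⟨ cong₂ (λ x y → x * y * b ^ (D * u))
                                                    (^-comm-^ k D v) (^-*-assoc b j v) ⟩
    (k ^ v) ^ D * b ^ (j * v) * b ^ (D * u) ≡⟨ xy∙z≈xz∙y ((k ^ v) ^ D) (b ^ (j * v)) (b ^ (D * u)) ⟩
    (k ^ v) ^ D * b ^ (D * u) * b ^ (j * v) ≡⟨ cong (λ x → (k ^ v) ^ D * x * b ^ (j * v)) b^Du ⟩
    (k ^ v) ^ D * (b ^ u) ^ D * b ^ (j * v) ≡⟨ cong (_* b ^ (j * v)) (^-distrib-* (k ^ v) (b ^ u) D) ⟨
    (k ^ v * b ^ u) ^ D * b ^ (j * v)      ≤⟨ *-monoˡ-≤ _ (^-monoˡ-≤ D many) ⟩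
    (a ^ u) ^ D * b ^ (j * v)              ≡⟨ cong (_* b ^ (j * v)) a^Du ⟩
    a ^ (D * u) * b ^ (j * v)              ∎)
  where
  open ≤-Reasoning
  b^Du : b ^ (D * u) ≡ (b ^ u) ^ D
  b^Du = trans (cong (b ^_) (*-comm D u)) (≡.sym (^-*-assoc b u D))
  a^Du : (a ^ u) ^ D ≡ a ^ (D * u)
  a^Du = trans (^-*-assoc a u D) (cong (a ^_) (*-comm u D))

*≤⇒≤/ : ∀ {j v e} .{{_ : NonZero v}} → j * v ≤ e → j ≤ e / v
*≤⇒≤/ {j} {v} jv≤e = ≤-trans (≤-reflexive (≡.sym (m*n/n≡m j v))) (/-monoˡ-≤ v jv≤e)

^-bound : ∀ {N Y b J v e} .{{_ : NonZero b}} → N ≤ Y * b ^ J → J * v ≤ e → N ^ v ≤ Y ^ v * b ^ e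
^-bound {N} {Y} {b} {J} {v} {e} N≤ Jv≤e = begin
  N ^ v                ≤⟨ ^-monoˡ-≤ v N≤ ⟩
  (Y * b ^ J) ^ v      ≡⟨ ^-distrib-* Y (b ^ J) v ⟩
  Y ^ v * (b ^ J) ^ v  ≡⟨ cong (Y ^ v *_) (^-*-assoc b J v) ⟩
  Y ^ v * b ^ (J * v)  ≤⟨ *-monoʳ-≤ (Y ^ v) (^-monoʳ-≤ b Jv≤e) ⟩
  Y ^ v * b ^ e        ∎
  where open ≤-Reasoning

kernel-constant : ∀ d D J k .{{_ : NonZero d}} →
  d ^ (3 * D + J) * (suc d * (2 * k)) ≤ 8 * d ^ (3 * D + 1) * k * d ^ J
kernel-constant d D J k = begin
  d ^ (3 * D + J) * (suc d * (2 * k))       ≤⟨ *-monoʳ-≤ (d ^ (3 * D + J))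
                                                 (*-monoˡ-≤ (2 * k) 1+d≤2d) ⟩
  d ^ (3 * D + J) * (2 * d * (2 * k))       ≡⟨ cong (_* (2 * d * (2 * k)))
                                                 (^-distribˡ-+-* d (3 * D) J) ⟩
  d ^ (3 * D) * d ^ J * (2 * d * (2 * k))   ≤⟨ m≤m+n _ _ ⟩
  _                                         ≡⟨ double (d ^ (3 * D)) (d ^ J) d k ⟩
  8 * (d ^ (3 * D) * (d * 1)) * k * d ^ J   ≡⟨ cong (λ x → 8 * x * k * d ^ J)
                                                 (^-distribˡ-+-* d (3 * D) 1) ⟨
  8 * d ^ (3 * D + 1) * k * d ^ J           ∎
  where
  open ≤-Reasoning
  1+d≤2d : suc d ≤ 2 * d
  1+d≤2d = ≤-trans (≤-reflexive (+-comm 1 d)) (+-monoʳ-≤ d (≤-trans (>-nonZero⁻¹ d) (m≤m+n d 0)))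
  double : ∀ P Q d k →
    P * Q * (2 * d * (2 * k)) + P * Q * (2 * d * (2 * k)) ≡ 8 * (P * (d * 1)) * k * Q
  double = solve-∀

module Kernel (ℋ : List AnyGraph) (D : ℕ) (diameter : ∀ H → H ∈ ℋ → ConnDiamLe H D)
              {n : ℕ} (G G′ : Graph n) (G′⊆G : IsEdgeDeletion G G′) (G′-free : Free ℋ G′)
              (c : ℕ) (degree-G′ : ∀ x → degree G′ x ≤ suc c) where

  open EdgeDeletion G G′ G′⊆G
  open Ball G touched

  near-touched : ∀ {w} → InVH ℋ G w ⊎ InVR G (suc c) w → ∃ λ x → touched x ≡ true × DistLe G w x D
  near-touched (inj₁ ((m , H) , H∈ℋ , (f , f-inj , f-adj) , a₀ , refl))
    with destroyed-copy⇒touched {H = H} (f , f-inj , f-adj) (G′-free (m , H) H∈ℋ)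
  ... | a , touched-fa with proj₂ (diameter (m , H) H∈ℋ) a₀ a
  ...   | ℓ , ℓ≤D , a₀⇝a = f a , touched-fa , ℓ , ℓ≤D , walk-map f f-adj a₀⇝a
  near-touched {w} (inj₂ high-degree) = w , ¬-not untouched-impossible , 0 , z≤n , here
    where
    untouched-impossible : touched w ≢ false
    untouched-impossible untouched =
      <⇒≱ high-degree (≤-trans (≤-reflexive (untouched⇒degree≡ untouched)) (degree-G′ w))

  kept⇒∈ball : ∀ {k j v} → (∀ m → WithinThreshold (suc c) k D m → m ∸ 2 * D ≤ j) →
    Kept ℋ G (suc c) k D v → v ∈ ball (3 * D + j)
  kept⇒∈ball {j = j} close (w , w∈ , m , v⇝w , within) with near-touched w∈
  ... | x , touched-x , ℓ , ℓ≤D , w⇝x =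
    walk⇒∈ball (3 * D + j) (walk-++ v⇝w w⇝x) touched-x (begin
    m + ℓ                    ≤⟨ +-mono-≤ (m≤n+m∸n m (2 * D)) ℓ≤D ⟩
    2 * D + (m ∸ 2 * D) + D  ≤⟨ +-monoˡ-≤ D (+-monoʳ-≤ (2 * D) (close m within)) ⟩
    2 * D + j + D            ≡⟨ regroup D j ⟩
    3 * D + j                ∎)
    where
    open ≤-Reasoning
    regroup : ∀ D j → 2 * D + j + D ≡ 3 * D + j
    regroup = solve-∀

  kernel-size : ∀ {k} → removedEdges G G′ ≤ k → (L : List (Fin n)) → Unique L →
    All (Kept ℋ G (suc c) k D) L → SizeBound (suc c) k D (length L)
  kernel-size {k} removed≤k L L-unique L-kept u (suc v) _ k^v<ratio^u =
    ^-bound {Y = 8 * d ^ (3 * D + 1) * k} {J = J} length-L (m/n*n≤m (D * u) (suc v))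
    where
    d = suc c
    J = (D * u) / suc v
    -- 2 * d ∸ 1 reduces to c + suc (c + 0).
    0<2d∸1 : 0 < 2 * d ∸ 1
    0<2d∸1 = ≤-trans (s≤s z≤n) (m≤n+m (suc (c + 0)) c)
    2d∸1<2d : 2 * d ∸ 1 < 2 * d
    2d∸1<2d = ≤-refl
    close : ∀ m → WithinThreshold d k D m → m ∸ 2 * D ≤ J
    close m within = *≤⇒≤/ (threshold⇒exponent≤ {k = k} {D} {u} {suc v} {m ∸ 2 * D}
      0<2d∸1 2d∸1<2d within (<⇒≤ k^v<ratio^u))
    low-degree : ∀ {x} → touched x ≡ false → degree G x ≤ d
    low-degree {x} untouched = ≤-trans (≤-reflexive (untouched⇒degree≡ untouched)) (degree-G′ x)
    few-exits : ∀ {x} → touched x ≡ true → count (exits x) ≤ d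
    few-exits {x} _ = ≤-trans (count-untouched-neighbours x) (degree-G′ x)
    length-L : length L ≤ 8 * d ^ (3 * D + 1) * k * d ^ J
    length-L = begin
      length L                                  ≤⟨ Unique-⊆⇒length≤ L-unique
                                                     (kept⇒∈ball close ∘ All.lookup L-kept) ⟩
      length (ball (3 * D + J))                 ≤⟨ length-ball low-degree few-exits (3 * D + J) ⟩
      d ^ (3 * D + J) * (suc d * count touched) ≤⟨ *-monoʳ-≤ (d ^ (3 * D + J)) (*-monoʳ-≤ (suc d)
                                                     (≤-trans count-touched (*-monoʳ-≤ 2 removed≤k))) ⟩
      d ^ (3 * D + J) * (suc d * (2 * k))       ≤⟨ kernel-constant d D J k ⟩
      8 * d ^ (3 * D + 1) * k * d ^ J           ∎
      where open ≤-Reasoning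

lemma12 : (ℋ : List AnyGraph) (D s t R d k n : ℕ) (G : Graph n)
    → (∀ H → H ∈ ℋ → ConnDiamLe H D)
    → 1 < s → ContainsStar ℋ s → (∀ s′ → 1 < s′ → s′ < s → ¬ ContainsStar ℋ s′)
    → 2 < t → IsRamseyNumber s (t ∸ 1) R → d ≡ R ∸ 1
    → 1 ≤ k → YesInstance ℋ G k → ¬ HasClique G t
    → (L : List (Fin n)) → Unique L → All (Kept ℋ G d k D) L
    → SizeBound d k D (length L)
lemma12 ℋ D s (suc t) R d k n G diameter 1<s (H★ , H★∈ℋ , H★≅star) _ (s≤s 2≤t) (ramsey , _)
        d≡R∸1 _ (G′ , G′⊆G , removed≤k , G′-free) no-clique L L-unique L-kept
  with m≤n⇒∃[o]m+o≡n (ramsey-number≥2 1<s 2≤t ramsey) | d≡R∸1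
... | c , refl | refl =
  Kernel.kernel-size ℋ D diameter G G′ G′⊆G G′-free c degree-G′ removed≤k L L-unique L-kept
  where
  degree-G′ : ∀ x → degree G′ x ≤ suc c
  degree-G′ x = ≤-pred (degree<Ramsey G′ ramsey no-star-in-G′ no-clique-in-G′ x)
    where
    no-star-in-G′ : ¬ InducedEmb (star s) G′
    no-star-in-G′ = G′-free H★ H★∈ℋ ∘ InducedEmb-resp-Iso {H★} {star s} {G = G′} H★≅star
    no-clique-in-G′ : ¬ HasClique G′ (suc t)
    no-clique-in-G′ = no-clique ∘ HasClique-resp-deletion {G = G} {G′} G′⊆G
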